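{- Let $S\in\mathbb{Z}^{m\times m}$ be a nonsingular matrix in Smith form, $F\in\mathbb{Z}^{n\times m}$, and let $H\in\mathbb{Z}^{n\times n}$ be the Hermite basis of $\mathcal{R}(S,F)$. Let $n=n_1+n_2$, write $H=\begin{bmatrix}\bar H_1 & H_{12}\\ 0 & \bar H_2\end{bmatrix}$ with $\bar H_1\in\mathbb{Z}^{n_1\times n_1}$, and set $H_1=\begin{bmatrix}\bar H_1 & 0\\ 0 & I_{n_2}\end{bmatrix}$, $H_2=\begin{bmatrix} I_{n_1} & H_{12}\\ 0&\bar H_2\end{bmatrix}$, so $H=H_2H_1$. Let $A$ be the last $n_2$ rows of $F$ and let $T$ be the Hermite basis of $\begin{bmatrix} S\\ A\end{bmatrix}$. Then: (1) $H_2$ is the Hermite basis of $\mathcal{R}(S,H_1F)$; (2) the Hermite basis of $\begin{bmatrix} S \\ H_1 F \end{bmatrix}$ is equal to $T$.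
   Context: A nonsingular integer matrix in Smith form is diagonal with positive diagonal entries $s_1\mid\cdots\mid s_m$. For $M$ of full column rank and $F$ with the same number of columns, $\mathcal{R}(M,F)=\{p\in\mathbb{Z}^{1\times n}: pF=qM\text{ for some integer row vector } q\}$; its Hermite basis is the unique nonsingular $n\times n$ integer matrix in (row) Hermite form (upper triangular, positive diagonal, entries above each diagonal entry $h_j$ in column $j$ in $[0,h_j)$) whose rows generate it. The Hermite basis of a full column rank integer matrix $X$ is the square nonsingular Hermite-form matrix generating the same row lattice as $X$. -}

module Defs where

open import Data.Nat using (ℕ; zero; suc)
open import Data.Integer using (ℤ; _+_; _*_; _<_; _≤_; 0ℤ; 1ℤ)
open import Data.Integer.Divisibility using (_∣_)
open import Data.Fin using (Fin; splitAt; _↑ˡ_; _↑ʳ_; _≟_)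
import Data.Fin as Fin
open import Data.Sum using (_⊎_; inj₁; inj₂; [_,_])
open import Data.Product using (_×_; Σ)
open import Relation.Binary.PropositionalEquality using (_≡_; _≢_)
open import Relation.Nullary using (does)
open import Data.Bool using (if_then_else_)
open import Function.Bundles using (_⇔_)

Mat : ℕ → ℕ → Set
Mat r c = Fin r → Fin c → ℤ

Row : ℕ → Set
Row c = Fin c → ℤ

sumF : {k : ℕ} → (Fin k → ℤ) → ℤ
sumF {zero} f = 0ℤ
sumF {suc k} f = f Fin.zero + sumF (λ i → f (Fin.suc i))

vecMat : {r c : ℕ} → Row r → Mat r c → Row c
vecMat q M j = sumF (λ i → q i * M i j)

_⊗_ : {r k c : ℕ} → Mat r k → Mat k c → Mat r c
(A ⊗ B) i j = sumF (λ l → A i l * B l j)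

Id : (k : ℕ) → Mat k k
Id k i j = if does (i ≟ j) then 1ℤ else 0ℤ

Zero : (r c : ℕ) → Mat r c
Zero r c i j = 0ℤ

block : {r₁ r₂ c₁ c₂ : ℕ} → Mat r₁ c₁ → Mat r₁ c₂ → Mat r₂ c₁ → Mat r₂ c₂
      → Mat (r₁ Data.Nat.+ r₂) (c₁ Data.Nat.+ c₂)
block {r₁} {r₂} {c₁} {c₂} A B C D k l with splitAt r₁ k | splitAt c₁ l
... | inj₁ i | inj₁ j = A i j
... | inj₁ i | inj₂ j = B i j
... | inj₂ i | inj₁ j = C i j
... | inj₂ i | inj₂ j = D i j

stack : {r₁ r₂ c : ℕ} → Mat r₁ c → Mat r₂ c → Mat (r₁ Data.Nat.+ r₂) c
stack {r₁} X Y k j = [ (λ i → X i j) , (λ i → Y i j) ] (splitAt r₁ k)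

blk11 : {n₁ n₂ : ℕ} → Mat (n₁ Data.Nat.+ n₂) (n₁ Data.Nat.+ n₂) → Mat n₁ n₁
blk11 {n₁} {n₂} H i j = H (i ↑ˡ n₂) (j ↑ˡ n₂)

blk12 : {n₁ n₂ : ℕ} → Mat (n₁ Data.Nat.+ n₂) (n₁ Data.Nat.+ n₂) → Mat n₁ n₂
blk12 {n₁} {n₂} H i j = H (i ↑ˡ n₂) (n₁ ↑ʳ j)

blk22 : {n₁ n₂ : ℕ} → Mat (n₁ Data.Nat.+ n₂) (n₁ Data.Nat.+ n₂) → Mat n₂ n₂
blk22 {n₁} {n₂} H i j = H (n₁ ↑ʳ i) (n₁ ↑ʳ j)

lastRows : {n₁ n₂ c : ℕ} → Mat (n₁ Data.Nat.+ n₂) c → Mat n₂ c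
lastRows {n₁} F i j = F (n₁ ↑ʳ i) j

IsSmith : {m : ℕ} → Mat m m → Set
IsSmith {m} S =
  ((i j : Fin m) → i ≢ j → S i j ≡ 0ℤ)
  × ((i : Fin m) → 0ℤ < S i i)
  × ((i j : Fin m) → i Fin.≤ j → S i i ∣ S j j)

IsHermite : {n : ℕ} → Mat n n → Set
IsHermite {n} H =
  ((i j : Fin n) → j Fin.< i → H i j ≡ 0ℤ)
  × ((i : Fin n) → 0ℤ < H i i)
  × ((i j : Fin n) → i Fin.< j → (0ℤ ≤ H i j) × (H i j < H j j))

RowLattice : {r c : ℕ} → Mat r c → Row c → Set
RowLattice {r} X p = Σ (Row r) λ q → (j : _) → p j ≡ vecMat q X j

RLat : {n m k : ℕ} → Mat k m → Mat n m → Row n → Set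
RLat {k = k} M F p = Σ (Row k) λ q → (j : _) → vecMat p F j ≡ vecMat q M j

IsHermiteBasisOf : {n : ℕ} → Mat n n → (Row n → Set) → Set
IsHermiteBasisOf {n} H L = IsHermite H × ((p : Row n) → L p ⇔ RowLattice H p)

IsHermiteBasisOfMat : {r c : ℕ} → Mat c c → Mat r c → Set
IsHermiteBasisOfMat H X = IsHermiteBasisOf H (RowLattice X)

{-# OPTIONS --safe #-}
-- H₁ is upper triangular with nonzero diagonal, so p ↦ p H₁ is injective on row vectors.
-- Hence p ∈ R(S, H₁F) iff p H₁ ∈ R(S, F), which is the row lattice of H = H₂ H₁, iff p lies
-- in the row lattice of H₂; and H₂ inherits the Hermite conditions from H.
-- For (2): the last n₂ rows of H₁F are those of F, i.e. A, and its first n₁ rows are the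
-- first n₁ rows of H F minus H₁₂ A. Every row of H F lies in the row lattice of S, because
-- every row of H lies in R(S, F). So [S; H₁F] and [S; A] generate the same lattice.
module Submission where

open import Defs
open import Data.Nat using (ℕ)
import Data.Nat as ℕ

module IntegerMatrices where

  open import Data.Nat using (zero; suc)
  import Data.Nat.Properties as ℕ
  open import Data.Integer using (ℤ; _+_; _*_; -_; _-_; 0ℤ; 1ℤ; -1ℤ)
  open import Data.Integer.Properties
    using ( +-*-semiring; +-identityˡ; +-identityʳ; +-assoc; +-inverseʳ; *-assoc; *-zeroʳ; *-identityˡ; *-identityʳ
          ; *-distribʳ-+; neg-distribˡ-*; -1*i≡-i; i-j≡0⇒i≡j; i*j≡0⇒i≡0∨j≡0)
  open import Algebra.Properties.Semiring.Sum +-*-semiring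
    using (sum; sum-cong-≗; sum-replicate-zero; sum-remove; ∑-distrib-+; ∑-comm; *-distribˡ-sum; *-distribʳ-sum)
  open import Data.Fin using (Fin; _↑ˡ_; _↑ʳ_; _≟_; toℕ; punchIn)
  import Data.Fin as Fin
  open import Data.Fin.Properties using (toℕ-↑ˡ; toℕ-↑ʳ; toℕ<n; splitAt-↑ˡ; splitAt-↑ʳ; punchInᵢ≢i)
  open import Data.Product using (_,_; proj₁; proj₂)
  open import Data.Sum using (inj₁; inj₂)
  open import Function using (_∘_; _⇔_; mk⇔)
  open import Relation.Binary.PropositionalEquality
  open import Relation.Nullary using (contradiction)
  open import Relation.Nullary.Decidable using (dec-true; dec-false)

  variable
    k r c : ℕ

  sumF≡sum : (f : Fin k → ℤ) → sumF f ≡ sum f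
  sumF≡sum {zero} f = refl
  sumF≡sum {suc k} f = cong (f Fin.zero +_) (sumF≡sum (f ∘ Fin.suc))

  sumF-cong : {f g : Fin k → ℤ} → (∀ i → f i ≡ g i) → sumF f ≡ sumF g
  sumF-cong {f = f} {g} f≗g = trans (sumF≡sum f) (trans (sum-cong-≗ f≗g) (sym (sumF≡sum g)))

  sumF-zero : {f : Fin k → ℤ} → (∀ i → f i ≡ 0ℤ) → sumF f ≡ 0ℤ
  sumF-zero {k} f≗0 = trans (sumF-cong {g = λ _ → 0ℤ} f≗0) (trans (sumF≡sum {k} (λ _ → 0ℤ)) (sum-replicate-zero k))

  sumF-single : (f : Fin k → ℤ) (i : Fin k) → (∀ j → j ≢ i → f j ≡ 0ℤ) → sumF f ≡ f i
  sumF-single {suc k} f i vanishes = begin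
    sumF f                           ≡⟨ sumF≡sum f ⟩
    sum f                            ≡⟨ sum-remove f ⟩
    f i + sum (f ∘ punchIn i)        ≡⟨ cong (f i +_) (sym (sumF≡sum (f ∘ punchIn i))) ⟩
    f i + sumF (f ∘ punchIn i)       ≡⟨ cong (f i +_) (sumF-zero (λ j → vanishes _ (punchInᵢ≢i i j))) ⟩
    f i + 0ℤ                         ≡⟨ +-identityʳ (f i) ⟩
    f i                              ∎
    where open ≡-Reasoning

  sumF-splitAt : ∀ n₁ {n₂} (f : Fin (n₁ ℕ.+ n₂) → ℤ)
               → sumF f ≡ sumF (f ∘ (_↑ˡ n₂)) + sumF (f ∘ (n₁ ↑ʳ_))
  sumF-splitAt zero f = sym (+-identityˡ _)
  sumF-splitAt (suc n₁) {n₂} f =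
    trans (cong (f Fin.zero +_) (sumF-splitAt n₁ (f ∘ Fin.suc)))
      (sym (+-assoc (f Fin.zero) (sumF (f ∘ Fin.suc ∘ (_↑ˡ n₂))) (sumF (f ∘ Fin.suc ∘ (n₁ ↑ʳ_)))))

  sumF-comm : (f : Fin r → Fin c → ℤ)
            → sumF (λ i → sumF (f i)) ≡ sumF (λ j → sumF (λ i → f i j))
  sumF-comm f = begin
    sumF (λ i → sumF (f i))            ≡⟨ trans (sumF≡sum (sumF ∘ f)) (sum-cong-≗ (sumF≡sum ∘ f)) ⟩
    sum (λ i → sum (f i))              ≡⟨ ∑-comm f ⟩
    sum (λ j → sum (λ i → f i j))      ≡⟨ sym (trans (sumF≡sum (λ j → sumF (λ i → f i j)))
                                                     (sum-cong-≗ (λ j → sumF≡sum (λ i → f i j)))) ⟩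
    sumF (λ j → sumF (λ i → f i j))    ∎
    where open ≡-Reasoning

  sumF-distribˡ : ∀ x (f : Fin k → ℤ) → x * sumF f ≡ sumF (λ i → x * f i)
  sumF-distribˡ x f = trans (cong (x *_) (sumF≡sum f)) (trans (*-distribˡ-sum x f) (sym (sumF≡sum (λ i → x * f i))))

  sumF-distribʳ : ∀ x (f : Fin k → ℤ) → sumF f * x ≡ sumF (λ i → f i * x)
  sumF-distribʳ x f = trans (cong (_* x) (sumF≡sum f)) (trans (*-distribʳ-sum x f) (sym (sumF≡sum (λ i → f i * x))))

  sumF-distrib-+ : (f g : Fin k → ℤ) → sumF (λ i → f i + g i) ≡ sumF f + sumF g
  sumF-distrib-+ f g = begin
    sumF (λ i → f i + g i)  ≡⟨ sumF≡sum (λ i → f i + g i) ⟩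
    sum (λ i → f i + g i)   ≡⟨ ∑-distrib-+ f g ⟩
    sum f + sum g           ≡⟨ sym (cong₂ _+_ (sumF≡sum f) (sumF≡sum g)) ⟩
    sumF f + sumF g         ∎
    where open ≡-Reasoning

  Id-diag : (i : Fin k) → Id k i i ≡ 1ℤ
  Id-diag i rewrite dec-true (i ≟ i) refl = refl

  Id-offDiag : {i j : Fin k} → i ≢ j → Id k i j ≡ 0ℤ
  Id-offDiag {i = i} {j} i≢j rewrite dec-false (i ≟ j) i≢j = refl

  vecMat-congˡ : {p q : Row r} (M : Mat r c) (j : Fin c) → (∀ i → p i ≡ q i) → vecMat p M j ≡ vecMat q M j
  vecMat-congˡ M j p≗q = sumF-cong (λ i → cong (_* M i j) (p≗q i))

  vecMat-congʳ : ∀ {c′} (p : Row r) (M : Mat r c) (N : Mat r c′) (j : Fin c) (j′ : Fin c′)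
               → (∀ i → M i j ≡ N i j′) → vecMat p M j ≡ vecMat p N j′
  vecMat-congʳ p M N j j′ Mj≗Nj = sumF-cong (λ i → cong (p i *_) (Mj≗Nj i))

  vecMat-zeroˡ : {p : Row r} (M : Mat r c) (j : Fin c) → (∀ i → p i ≡ 0ℤ) → vecMat p M j ≡ 0ℤ
  vecMat-zeroˡ M j p≗0 = sumF-zero (λ i → cong (_* M i j) (p≗0 i))

  vecMat-zeroʳ : (p : Row r) (M : Mat r c) (j : Fin c) → (∀ i → M i j ≡ 0ℤ) → vecMat p M j ≡ 0ℤ
  vecMat-zeroʳ p M j Mj≗0 = sumF-zero (λ i → trans (cong (p i *_) (Mj≗0 i)) (*-zeroʳ (p i)))

  vecMat-Idˡ : (i : Fin r) (M : Mat r c) (j : Fin c) → vecMat (Id r i) M j ≡ M i j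
  vecMat-Idˡ i M j = trans
    (sumF-single _ i (λ l l≢i → cong (_* M l j) (Id-offDiag (l≢i ∘ sym))))
    (trans (cong (_* M i j) (Id-diag i)) (*-identityˡ (M i j)))

  vecMat-Idʳ : (p : Row k) (j : Fin k) → vecMat p (Id k) j ≡ p j
  vecMat-Idʳ p j = trans
    (sumF-single _ j (λ l l≢j → trans (cong (p l *_) (Id-offDiag l≢j)) (*-zeroʳ (p l))))
    (trans (cong (p j *_) (Id-diag j)) (*-identityʳ (p j)))

  vecMat-distrib-+ : (p q : Row r) (M : Mat r c) (j : Fin c)
                   → vecMat (λ i → p i + q i) M j ≡ vecMat p M j + vecMat q M j
  vecMat-distrib-+ p q M j = trans
    (sumF-cong (λ i → *-distribʳ-+ (M i j) (p i) (q i)))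
    (sumF-distrib-+ (λ i → p i * M i j) (λ i → q i * M i j))

  vecMat-neg : (p : Row r) (M : Mat r c) (j : Fin c) → vecMat (λ i → - p i) M j ≡ - vecMat p M j
  vecMat-neg p M j = begin
    vecMat (λ i → - p i) M j         ≡⟨ sumF-cong (λ i → trans (sym (neg-distribˡ-* (p i) (M i j))) (sym (-1*i≡-i _))) ⟩
    sumF (λ i → -1ℤ * (p i * M i j))  ≡⟨ sym (sumF-distribˡ -1ℤ (λ i → p i * M i j)) ⟩
    -1ℤ * vecMat p M j                ≡⟨ -1*i≡-i _ ⟩
    - vecMat p M j                    ∎
    where open ≡-Reasoning

  vecMat-assoc : (p : Row r) (A : Mat r k) (B : Mat k c) (j : Fin c)
               → vecMat (vecMat p A) B j ≡ vecMat p (A ⊗ B) j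
  vecMat-assoc p A B j = begin
    sumF (λ i → sumF (λ l → p l * A l i) * B i j)    ≡⟨ sumF-cong (λ i → sumF-distribʳ (B i j) (λ l → p l * A l i)) ⟩
    sumF (λ i → sumF (λ l → p l * A l i * B i j))    ≡⟨ sumF-comm (λ i l → p l * A l i * B i j) ⟩
    sumF (λ l → sumF (λ i → p l * A l i * B i j))    ≡⟨ sumF-cong (λ l → sumF-cong (λ i → *-assoc (p l) (A l i) (B i j))) ⟩
    sumF (λ l → sumF (λ i → p l * (A l i * B i j)))  ≡⟨ sumF-cong (λ l → sym (sumF-distribˡ (p l) (λ i → A l i * B i j))) ⟩
    vecMat p (A ⊗ B) j                               ∎
    where open ≡-Reasoning

  vecMat-splitAt : ∀ n₁ {n₂} (p : Row (n₁ ℕ.+ n₂)) (M : Mat (n₁ ℕ.+ n₂) c) (j : Fin c)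
                 → vecMat p M j
                 ≡ vecMat (p ∘ (_↑ˡ n₂)) (M ∘ (_↑ˡ n₂)) j + vecMat (p ∘ (n₁ ↑ʳ_)) (M ∘ (n₁ ↑ʳ_)) j
  vecMat-splitAt n₁ p M j = sumF-splitAt n₁ (λ i → p i * M i j)

  data SplitAt (n₁ n₂ : ℕ) : Fin (n₁ ℕ.+ n₂) → Set where
    left  : (i : Fin n₁) → SplitAt n₁ n₂ (i ↑ˡ n₂)
    right : (j : Fin n₂) → SplitAt n₁ n₂ (n₁ ↑ʳ j)

  splitAt-view : ∀ n₁ n₂ (l : Fin (n₁ ℕ.+ n₂)) → SplitAt n₁ n₂ l
  splitAt-view zero n₂ l = right l
  splitAt-view (suc n₁) n₂ Fin.zero = left Fin.zero
  splitAt-view (suc n₁) n₂ (Fin.suc l) with splitAt-view n₁ n₂ l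
  ... | left i = left (Fin.suc i)
  ... | right j = right j

  ↑ˡ<↑ʳ : ∀ {n₁ n₂} (i : Fin n₁) (j : Fin n₂) → i ↑ˡ n₂ Fin.< n₁ ↑ʳ j
  ↑ˡ<↑ʳ {n₁} {n₂} i j = subst₂ ℕ._<_ (sym (toℕ-↑ˡ i n₂)) (sym (toℕ-↑ʳ n₁ j))
    (ℕ.<-≤-trans (toℕ<n i) (ℕ.m≤m+n n₁ (toℕ j)))

  ↑ˡ-cancel-< : ∀ {n₁} n₂ {i j : Fin n₁} → i ↑ˡ n₂ Fin.< j ↑ˡ n₂ → i Fin.< j
  ↑ˡ-cancel-< n₂ {i} {j} = subst₂ ℕ._<_ (toℕ-↑ˡ i n₂) (toℕ-↑ˡ j n₂)

  ↑ʳ-cancel-< : ∀ n₁ {n₂} {i j : Fin n₂} → n₁ ↑ʳ i Fin.< n₁ ↑ʳ j → i Fin.< j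
  ↑ʳ-cancel-< n₁ {i = i} {j} lt =
    ℕ.+-cancelˡ-< n₁ (toℕ i) (toℕ j) (subst₂ ℕ._<_ (toℕ-↑ʳ n₁ i) (toℕ-↑ʳ n₁ j) lt)

  module Block {r₁ r₂ c₁ c₂ : ℕ} (A : Mat r₁ c₁) (B : Mat r₁ c₂) (C : Mat r₂ c₁) (D : Mat r₂ c₂) where

    ↑ˡ-↑ˡ : ∀ i j → block A B C D (i ↑ˡ r₂) (j ↑ˡ c₂) ≡ A i j
    ↑ˡ-↑ˡ i j rewrite splitAt-↑ˡ r₁ i r₂ | splitAt-↑ˡ c₁ j c₂ = refl

    ↑ˡ-↑ʳ : ∀ i j → block A B C D (i ↑ˡ r₂) (c₁ ↑ʳ j) ≡ B i j
    ↑ˡ-↑ʳ i j rewrite splitAt-↑ˡ r₁ i r₂ | splitAt-↑ʳ c₁ c₂ j = refl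

    ↑ʳ-↑ˡ : ∀ i j → block A B C D (r₁ ↑ʳ i) (j ↑ˡ c₂) ≡ C i j
    ↑ʳ-↑ˡ i j rewrite splitAt-↑ʳ r₁ r₂ i | splitAt-↑ˡ c₁ j c₂ = refl

    ↑ʳ-↑ʳ : ∀ i j → block A B C D (r₁ ↑ʳ i) (c₁ ↑ʳ j) ≡ D i j
    ↑ʳ-↑ʳ i j rewrite splitAt-↑ʳ r₁ r₂ i | splitAt-↑ʳ c₁ c₂ j = refl

  module _ {r₁ r₂ : ℕ} (X : Mat r₁ c) (Y : Mat r₂ c) where

    stack-↑ˡ : ∀ i j → stack X Y (i ↑ˡ r₂) j ≡ X i j
    stack-↑ˡ i j rewrite splitAt-↑ˡ r₁ i r₂ = refl

    stack-↑ʳ : ∀ i j → stack X Y (r₁ ↑ʳ i) j ≡ Y i j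
    stack-↑ʳ i j rewrite splitAt-↑ʳ r₁ r₂ i = refl

  UpperTriangular : Mat k k → Set
  UpperTriangular {k} M = (i j : Fin k) → j Fin.< i → M i j ≡ 0ℤ

  Nonsingular : Mat k k → Set
  Nonsingular {k} M = (u : Row k) → (∀ j → vecMat u M j ≡ 0ℤ) → ∀ i → u i ≡ 0ℤ

  upperTriangular⇒nonsingular : (M : Mat k k) → UpperTriangular M → (∀ i → M i i ≢ 0ℤ) → Nonsingular M
  upperTriangular⇒nonsingular {suc k} M upper diag≢0 u uM≡0 = u≡0
    where
    open ≡-Reasoning
    M₊ : Mat k k
    M₊ i j = M (Fin.suc i) (Fin.suc j)

    u₀M₀₀≡0 : u Fin.zero * M Fin.zero Fin.zero ≡ 0ℤ
    u₀M₀₀≡0 = begin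
      u Fin.zero * M Fin.zero Fin.zero
        ≡⟨ sym (+-identityʳ _) ⟩
      u Fin.zero * M Fin.zero Fin.zero + 0ℤ
        ≡⟨ cong (u Fin.zero * M Fin.zero Fin.zero +_)
                (sym (vecMat-zeroʳ (u ∘ Fin.suc) (M ∘ Fin.suc) Fin.zero (λ i → upper (Fin.suc i) Fin.zero ℕ.z<s))) ⟩
      vecMat u M Fin.zero
        ≡⟨ uM≡0 Fin.zero ⟩
      0ℤ
        ∎

    u₀≡0 : u Fin.zero ≡ 0ℤ
    u₀≡0 with i*j≡0⇒i≡0∨j≡0 (u Fin.zero) u₀M₀₀≡0
    ... | inj₁ u₀≡0 = u₀≡0
    ... | inj₂ M₀₀≡0 = contradiction M₀₀≡0 (diag≢0 Fin.zero)

    u₊M₊≡0 : ∀ j → vecMat (u ∘ Fin.suc) M₊ j ≡ 0ℤ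
    u₊M₊≡0 j = begin
      vecMat (u ∘ Fin.suc) M₊ j
        ≡⟨ sym (+-identityˡ _) ⟩
      0ℤ * M Fin.zero (Fin.suc j) + vecMat (u ∘ Fin.suc) M₊ j
        ≡⟨ cong (λ x → x * M Fin.zero (Fin.suc j) + vecMat (u ∘ Fin.suc) M₊ j) (sym u₀≡0) ⟩
      vecMat u M (Fin.suc j)
        ≡⟨ uM≡0 (Fin.suc j) ⟩
      0ℤ
        ∎

    u≡0 : ∀ i → u i ≡ 0ℤ
    u≡0 Fin.zero = u₀≡0
    u≡0 (Fin.suc i) = upperTriangular⇒nonsingular M₊ (λ i j j<i → upper _ _ (ℕ.s<s j<i))
                        (diag≢0 ∘ Fin.suc) (u ∘ Fin.suc) u₊M₊≡0 i

  module _ {X : Mat r c} where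

    RowLattice-resp : {p q : Row c} → (∀ j → p j ≡ q j) → RowLattice X p → RowLattice X q
    RowLattice-resp p≗q (w , p≡wX) = w , λ j → trans (sym (p≗q j)) (p≡wX j)

    RowLattice-row : (i : Fin r) → RowLattice X (X i)
    RowLattice-row i = Id r i , λ j → sym (vecMat-Idˡ i X j)

    RowLattice-+ : {p q : Row c} → RowLattice X p → RowLattice X q → RowLattice X (λ j → p j + q j)
    RowLattice-+ (v , p≡vX) (w , q≡wX) =
      (λ i → v i + w i) , λ j → trans (cong₂ _+_ (p≡vX j) (q≡wX j)) (sym (vecMat-distrib-+ v w X j))

    RowLattice-neg : {p : Row c} → RowLattice X p → RowLattice X (λ j → - p j)
    RowLattice-neg (w , p≡wX) = (λ i → - w i) , λ j → trans (cong -_ (p≡wX j)) (sym (vecMat-neg w X j))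

  RowLattice-⊆ : {X : Mat r c} {Y : Mat k c} → (∀ i → RowLattice Y (X i))
               → ∀ p → RowLattice X p → RowLattice Y p
  RowLattice-⊆ {X = X} {Y} rowsX⊆Y p (w , p≡wX) =
    vecMat w R , λ j → trans (p≡wX j) (trans (vecMat-congʳ w X (R ⊗ Y) j j (λ i → proj₂ (rowsX⊆Y i) j))
                                              (sym (vecMat-assoc w R Y j)))
    where
    R : Mat _ _
    R i = proj₁ (rowsX⊆Y i)

  RowLattice-≈ : {X : Mat r c} {Y : Mat k c} → (∀ i → RowLattice Y (X i)) → (∀ i → RowLattice X (Y i))
               → ∀ p → RowLattice X p ⇔ RowLattice Y p
  RowLattice-≈ X⊆Y Y⊆X p = mk⇔ (RowLattice-⊆ X⊆Y p) (RowLattice-⊆ Y⊆X p)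

  module _ {r₁ r₂ : ℕ} (X : Mat r₁ c) (Y : Mat r₂ c) where

    stack-rowˡ : ∀ i → RowLattice (stack X Y) (X i)
    stack-rowˡ i = RowLattice-resp (stack-↑ˡ X Y i) (RowLattice-row (i ↑ˡ r₂))

    stack-rowʳ : ∀ i → RowLattice (stack X Y) (Y i)
    stack-rowʳ i = RowLattice-resp (stack-↑ʳ X Y i) (RowLattice-row (r₁ ↑ʳ i))

  module _ {r₁ r₂ : ℕ} {X : Mat r₁ c} {Y : Mat r₂ c} where

    stack-rows : {Z : Mat k c} → (∀ i → RowLattice Z (X i)) → (∀ i → RowLattice Z (Y i))
               → ∀ l → RowLattice Z (stack X Y l)
    stack-rows rowsX rowsY l with splitAt-view r₁ r₂ l
    ... | left i = RowLattice-resp (λ j → sym (stack-↑ˡ X Y i j)) (rowsX i)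
    ... | right i = RowLattice-resp (λ j → sym (stack-↑ʳ X Y i j)) (rowsY i)

  RLat-⊗ : {S : Mat r c} {F : Mat k c} (K : Mat k k) (p : Row k) → RLat S (K ⊗ F) p ⇔ RLat S F (vecMat p K)
  RLat-⊗ {F = F} K p = mk⇔
    (λ (w , pKF≡wS) → w , λ j → trans (vecMat-assoc p K F j) (pKF≡wS j))
    (λ (w , pKF≡wS) → w , λ j → trans (sym (vecMat-assoc p K F j)) (pKF≡wS j))

  RowLattice-⊗-cancelʳ : {M H : Mat r k} (K : Mat k k) → Nonsingular K
                       → (∀ i j → (M ⊗ K) i j ≡ H i j) → ∀ p → RowLattice H (vecMat p K) ⇔ RowLattice M p
  RowLattice-⊗-cancelʳ {M = M} {H} K nonsingular MK≡H p = mk⇔ to from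
    where
    open ≡-Reasoning
    wMK≡wH : ∀ w j → vecMat (vecMat w M) K j ≡ vecMat w H j
    wMK≡wH w j = trans (vecMat-assoc w M K j) (vecMat-congʳ w (M ⊗ K) H j j (λ i → MK≡H i j))

    from : RowLattice M p → RowLattice H (vecMat p K)
    from (w , p≡wM) = w , λ j → trans (vecMat-congˡ K j p≡wM) (wMK≡wH w j)

    to : RowLattice H (vecMat p K) → RowLattice M p
    to (w , pK≡wH) = w , λ i → i-j≡0⇒i≡j (p i) (vecMat w M i) (nonsingular d dK≡0 i)
      where
      d : Row _
      d i = p i - vecMat w M i
      dK≡0 : ∀ j → vecMat d K j ≡ 0ℤ
      dK≡0 j = begin
        vecMat d K j                                      ≡⟨ vecMat-distrib-+ p (λ i → - vecMat w M i) K j ⟩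
        vecMat p K j + vecMat (λ i → - vecMat w M i) K j  ≡⟨ cong₂ _+_ (pK≡wH j) (vecMat-neg (vecMat w M) K j) ⟩
        vecMat w H j - vecMat (vecMat w M) K j            ≡⟨ cong (λ x → vecMat w H j - x) (wMK≡wH w j) ⟩
        vecMat w H j - vecMat w H j                       ≡⟨ +-inverseʳ (vecMat w H j) ⟩
        0ℤ                                                ∎

module HermiteSplitting {n₁ n₂ : ℕ} (H : Mat (n₁ ℕ.+ n₂) (n₁ ℕ.+ n₂)) where

  open IntegerMatrices
  open import Data.Integer using (ℤ; _+_; _-_; _<_; _≤_; 0ℤ; 1ℤ; +<+; +≤+)
  open import Data.Integer.Properties using (+-identityˡ; +-identityʳ; <⇒≢; +-0-abelianGroup)
  open import Algebra.Properties.AbelianGroup +-0-abelianGroup using (//-rightDividesʳ)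
  open import Data.Fin using (Fin; _↑ˡ_; _↑ʳ_)
  import Data.Fin as Fin
  import Data.Fin.Properties as Fin
  open import Data.Product using (_×_; _,_)
  open import Function using (_∘_; _⇔_; Equivalence)
  open import Function.Related.Propositional using (module EquationalReasoning)
  open import Relation.Binary.PropositionalEquality
  open import Relation.Nullary using (contradiction)

  H̄₁ : Mat n₁ n₁
  H̄₁ = blk11 H

  H₁₂ : Mat n₁ n₂
  H₁₂ = blk12 H

  H̄₂ : Mat n₂ n₂
  H̄₂ = blk22 H

  H₁ H₂ : Mat (n₁ ℕ.+ n₂) (n₁ ℕ.+ n₂)
  H₁ = block H̄₁ (Zero n₁ n₂) (Zero n₂ n₁) (Id n₂)
  H₂ = block (Id n₁) H₁₂ (Zero n₂ n₁) H̄₂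

  module H₁ = Block H̄₁ (Zero n₁ n₂) (Zero n₂ n₁) (Id n₂)
  module H₂ = Block (Id n₁) H₁₂ (Zero n₂ n₁) H̄₂

  vecMat-H₁-↑ˡ : (p : Row (n₁ ℕ.+ n₂)) (j : Fin n₁) → vecMat p H₁ (j ↑ˡ n₂) ≡ vecMat (p ∘ (_↑ˡ n₂)) H̄₁ j
  vecMat-H₁-↑ˡ p j = begin
    vecMat p H₁ (j ↑ˡ n₂)
      ≡⟨ vecMat-splitAt n₁ p H₁ (j ↑ˡ n₂) ⟩
    vecMat (p ∘ (_↑ˡ n₂)) (H₁ ∘ (_↑ˡ n₂)) (j ↑ˡ n₂) + vecMat (p ∘ (n₁ ↑ʳ_)) (H₁ ∘ (n₁ ↑ʳ_)) (j ↑ˡ n₂)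
      ≡⟨ cong₂ _+_ (vecMat-congʳ (p ∘ (_↑ˡ n₂)) (H₁ ∘ (_↑ˡ n₂)) H̄₁ (j ↑ˡ n₂) j (λ a → H₁.↑ˡ-↑ˡ a j))
                   (vecMat-zeroʳ (p ∘ (n₁ ↑ʳ_)) (H₁ ∘ (n₁ ↑ʳ_)) (j ↑ˡ n₂) (λ b → H₁.↑ʳ-↑ˡ b j)) ⟩
    vecMat (p ∘ (_↑ˡ n₂)) H̄₁ j + 0ℤ
      ≡⟨ +-identityʳ _ ⟩
    vecMat (p ∘ (_↑ˡ n₂)) H̄₁ j
      ∎
    where open ≡-Reasoning

  vecMat-H₁-↑ʳ : (p : Row (n₁ ℕ.+ n₂)) (j : Fin n₂) → vecMat p H₁ (n₁ ↑ʳ j) ≡ p (n₁ ↑ʳ j)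
  vecMat-H₁-↑ʳ p j = begin
    vecMat p H₁ (n₁ ↑ʳ j)
      ≡⟨ vecMat-splitAt n₁ p H₁ (n₁ ↑ʳ j) ⟩
    vecMat (p ∘ (_↑ˡ n₂)) (H₁ ∘ (_↑ˡ n₂)) (n₁ ↑ʳ j) + vecMat (p ∘ (n₁ ↑ʳ_)) (H₁ ∘ (n₁ ↑ʳ_)) (n₁ ↑ʳ j)
      ≡⟨ cong₂ _+_ (vecMat-zeroʳ (p ∘ (_↑ˡ n₂)) (H₁ ∘ (_↑ˡ n₂)) (n₁ ↑ʳ j) (λ a → H₁.↑ˡ-↑ʳ a j))
                   (vecMat-congʳ (p ∘ (n₁ ↑ʳ_)) (H₁ ∘ (n₁ ↑ʳ_)) (Id n₂) (n₁ ↑ʳ j) j (λ b → H₁.↑ʳ-↑ʳ b j)) ⟩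
    0ℤ + vecMat (p ∘ (n₁ ↑ʳ_)) (Id n₂) j
      ≡⟨ trans (+-identityˡ _) (vecMat-Idʳ (p ∘ (n₁ ↑ʳ_)) j) ⟩
    p (n₁ ↑ʳ j)
      ∎
    where open ≡-Reasoning

  H₂⊗H₁≡H : UpperTriangular H → ∀ k l → (H₂ ⊗ H₁) k l ≡ H k l
  H₂⊗H₁≡H upper k l with splitAt-view n₁ n₂ k | splitAt-view n₁ n₂ l
  ... | left i | left j = begin
    vecMat (H₂ (i ↑ˡ n₂)) H₁ (j ↑ˡ n₂)           ≡⟨ vecMat-H₁-↑ˡ (H₂ (i ↑ˡ n₂)) j ⟩
    vecMat (H₂ (i ↑ˡ n₂) ∘ (_↑ˡ n₂)) H̄₁ j        ≡⟨ vecMat-congˡ H̄₁ j (H₂.↑ˡ-↑ˡ i) ⟩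
    vecMat (Id n₁ i) H̄₁ j                        ≡⟨ vecMat-Idˡ i H̄₁ j ⟩
    H (i ↑ˡ n₂) (j ↑ˡ n₂)                        ∎
    where open ≡-Reasoning
  ... | left i | right j = trans (vecMat-H₁-↑ʳ (H₂ (i ↑ˡ n₂)) j) (H₂.↑ˡ-↑ʳ i j)
  ... | right i | left j = begin
    vecMat (H₂ (n₁ ↑ʳ i)) H₁ (j ↑ˡ n₂)           ≡⟨ vecMat-H₁-↑ˡ (H₂ (n₁ ↑ʳ i)) j ⟩
    vecMat (H₂ (n₁ ↑ʳ i) ∘ (_↑ˡ n₂)) H̄₁ j        ≡⟨ vecMat-zeroˡ H̄₁ j (H₂.↑ʳ-↑ˡ i) ⟩
    0ℤ                                           ≡⟨ sym (upper (n₁ ↑ʳ i) (j ↑ˡ n₂) (↑ˡ<↑ʳ j i)) ⟩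
    H (n₁ ↑ʳ i) (j ↑ˡ n₂)                        ∎
    where open ≡-Reasoning
  ... | right i | right j = trans (vecMat-H₁-↑ʳ (H₂ (n₁ ↑ʳ i)) j) (H₂.↑ʳ-↑ʳ i j)

  H₂-hermite : IsHermite H → IsHermite H₂
  H₂-hermite (upper , positive , reduced) = upper₂ , positive₂ , reduced₂
    where
    upper₂ : UpperTriangular H₂
    upper₂ k l l<k with splitAt-view n₁ n₂ k | splitAt-view n₁ n₂ l
    ... | left i | left j = trans (H₂.↑ˡ-↑ˡ i j) (Id-offDiag (Fin.<⇒≢ (↑ˡ-cancel-< n₂ l<k) ∘ sym))
    ... | left i | right j = contradiction l<k (Fin.<-asym (↑ˡ<↑ʳ i j))
    ... | right i | left j = H₂.↑ʳ-↑ˡ i j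
    ... | right i | right j = trans (H₂.↑ʳ-↑ʳ i j) (upper _ _ l<k)

    positive₂ : ∀ l → 0ℤ < H₂ l l
    positive₂ l with splitAt-view n₁ n₂ l
    ... | left i = subst (0ℤ <_) (sym (trans (H₂.↑ˡ-↑ˡ i i) (Id-diag i))) (+<+ ℕ.z<s)
    ... | right j = subst (0ℤ <_) (sym (H₂.↑ʳ-↑ʳ j j)) (positive (n₁ ↑ʳ j))

    Reduced : ℤ → ℤ → Set
    Reduced x d = 0ℤ ≤ x × x < d

    reduced₂ : ∀ k l → k Fin.< l → Reduced (H₂ k l) (H₂ l l)
    reduced₂ k l k<l with splitAt-view n₁ n₂ k | splitAt-view n₁ n₂ l
    ... | left i | left j =
      subst₂ Reduced (sym (trans (H₂.↑ˡ-↑ˡ i j) (Id-offDiag (Fin.<⇒≢ (↑ˡ-cancel-< n₂ k<l)))))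
                     (sym (trans (H₂.↑ˡ-↑ˡ j j) (Id-diag j)))
                     (+≤+ ℕ.z≤n , +<+ ℕ.z<s)
    ... | left i | right j = subst₂ Reduced (sym (H₂.↑ˡ-↑ʳ i j)) (sym (H₂.↑ʳ-↑ʳ j j)) (reduced _ _ k<l)
    ... | right i | left j = contradiction k<l (Fin.<-asym (↑ˡ<↑ʳ j i))
    ... | right i | right j = subst₂ Reduced (sym (H₂.↑ʳ-↑ʳ i j)) (sym (H₂.↑ʳ-↑ʳ j j)) (reduced _ _ k<l)

  H₁-upperTriangular : UpperTriangular H → UpperTriangular H₁
  H₁-upperTriangular upper k l l<k with splitAt-view n₁ n₂ k | splitAt-view n₁ n₂ l
  ... | left i | left j = trans (H₁.↑ˡ-↑ˡ i j) (upper _ _ l<k)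
  ... | left i | right j = contradiction l<k (Fin.<-asym (↑ˡ<↑ʳ i j))
  ... | right i | left j = H₁.↑ʳ-↑ˡ i j
  ... | right i | right j = trans (H₁.↑ʳ-↑ʳ i j) (Id-offDiag (Fin.<⇒≢ (↑ʳ-cancel-< n₁ l<k) ∘ sym))

  H₁-diagonal≢0 : (∀ i → 0ℤ < H i i) → ∀ l → H₁ l l ≢ 0ℤ
  H₁-diagonal≢0 positive l with splitAt-view n₁ n₂ l
  ... | left i = λ H₁ₗₗ≡0 → <⇒≢ (positive (i ↑ˡ n₂)) (sym (trans (sym (H₁.↑ˡ-↑ˡ i i)) H₁ₗₗ≡0))
  ... | right j = λ H₁ₗₗ≡0 → 1≢0 (trans (sym (Id-diag j)) (trans (sym (H₁.↑ʳ-↑ʳ j j)) H₁ₗₗ≡0))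
    where
    1≢0 : 1ℤ ≢ 0ℤ
    1≢0 ()

  H₂-lattice : ∀ {m} {S : Mat m m} {F : Mat (n₁ ℕ.+ n₂) m} → IsHermiteBasisOf H (RLat S F)
             → ∀ p → RLat S (H₁ ⊗ F) p ⇔ RowLattice H₂ p
  H₂-lattice {S = S} {F} ((upper , positive , _) , basis) p = begin
    RLat S (H₁ ⊗ F) p            ∼⟨ RLat-⊗ H₁ p ⟩
    RLat S F (vecMat p H₁)       ∼⟨ basis (vecMat p H₁) ⟩
    RowLattice H (vecMat p H₁)   ∼⟨ RowLattice-⊗-cancelʳ H₁ H₁-nonsingular (H₂⊗H₁≡H upper) p ⟩
    RowLattice H₂ p              ∎
    where
    open EquationalReasoning
    H₁-nonsingular : Nonsingular H₁
    H₁-nonsingular = upperTriangular⇒nonsingular H₁ (H₁-upperTriangular upper) (H₁-diagonal≢0 positive)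

  module _ {c : ℕ} (F : Mat (n₁ ℕ.+ n₂) c) where

    H₁⊗-↑ˡ : ∀ a j → (H₁ ⊗ F) (a ↑ˡ n₂) j ≡ (H̄₁ ⊗ (F ∘ (_↑ˡ n₂))) a j
    H₁⊗-↑ˡ a j = begin
      (H₁ ⊗ F) (a ↑ˡ n₂) j
        ≡⟨ vecMat-splitAt n₁ (H₁ (a ↑ˡ n₂)) F j ⟩
      vecMat (H₁ (a ↑ˡ n₂) ∘ (_↑ˡ n₂)) (F ∘ (_↑ˡ n₂)) j + vecMat (H₁ (a ↑ˡ n₂) ∘ (n₁ ↑ʳ_)) (lastRows F) j
        ≡⟨ cong₂ _+_ (vecMat-congˡ (F ∘ (_↑ˡ n₂)) j (H₁.↑ˡ-↑ˡ a)) (vecMat-zeroˡ (lastRows F) j (H₁.↑ˡ-↑ʳ a)) ⟩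
      (H̄₁ ⊗ (F ∘ (_↑ˡ n₂))) a j + 0ℤ
        ≡⟨ +-identityʳ _ ⟩
      (H̄₁ ⊗ (F ∘ (_↑ˡ n₂))) a j
        ∎
      where open ≡-Reasoning

    H₁⊗-↑ʳ : ∀ b j → (H₁ ⊗ F) (n₁ ↑ʳ b) j ≡ lastRows F b j
    H₁⊗-↑ʳ b j = begin
      (H₁ ⊗ F) (n₁ ↑ʳ b) j
        ≡⟨ vecMat-splitAt n₁ (H₁ (n₁ ↑ʳ b)) F j ⟩
      vecMat (H₁ (n₁ ↑ʳ b) ∘ (_↑ˡ n₂)) (F ∘ (_↑ˡ n₂)) j + vecMat (H₁ (n₁ ↑ʳ b) ∘ (n₁ ↑ʳ_)) (lastRows F) j
        ≡⟨ cong₂ _+_ (vecMat-zeroˡ (F ∘ (_↑ˡ n₂)) j (H₁.↑ʳ-↑ˡ b)) (vecMat-congˡ (lastRows F) j (H₁.↑ʳ-↑ʳ b)) ⟩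
      0ℤ + vecMat (Id n₂ b) (lastRows F) j
        ≡⟨ trans (+-identityˡ _) (vecMat-Idˡ b (lastRows F) j) ⟩
      lastRows F b j
        ∎
      where open ≡-Reasoning

  stack-H₁⊗-lattice : ∀ {m} {S : Mat m m} {F : Mat (n₁ ℕ.+ n₂) m} → IsHermiteBasisOf H (RLat S F)
                    → ∀ p → RowLattice (stack S (H₁ ⊗ F)) p ⇔ RowLattice (stack S (lastRows F)) p
  stack-H₁⊗-lattice {S = S} {F} (_ , basis) =
    RowLattice-≈ (stack-rows (stack-rowˡ S A) G-rows) (stack-rows (stack-rowˡ S G) A-rows)
    where
    A : Mat n₂ _
    A = lastRows F

    G : Mat (n₁ ℕ.+ n₂) _
    G = H₁ ⊗ F

    A-rows : ∀ b → RowLattice (stack S G) (A b)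
    A-rows b = RowLattice-resp (H₁⊗-↑ʳ F b) (stack-rowʳ S G (n₁ ↑ʳ b))

    G-rows : ∀ l → RowLattice (stack S A) (G l)
    G-rows l with splitAt-view n₁ n₂ l
    ... | right b = RowLattice-resp (sym ∘ H₁⊗-↑ʳ F b) (stack-rowʳ S A b)
    ... | left a = RowLattice-resp HF-H₁₂A≡G (RowLattice-+ HF-row (RowLattice-neg H₁₂A-row))
      where
      -- RLat S F p unfolds to RowLattice S (vecMat p F).
      HF-row : RowLattice (stack S A) ((H ⊗ F) (a ↑ˡ n₂))
      HF-row = RowLattice-⊆ (stack-rowˡ S A) _ (Equivalence.from (basis (H (a ↑ˡ n₂))) (RowLattice-row (a ↑ˡ n₂)))

      H₁₂A-row : RowLattice (stack S A) ((H₁₂ ⊗ A) a)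
      H₁₂A-row = RowLattice-⊆ (stack-rowʳ S A) _ (H₁₂ a , λ _ → refl)

      HF-H₁₂A≡G : ∀ j → (H ⊗ F) (a ↑ˡ n₂) j - (H₁₂ ⊗ A) a j ≡ G (a ↑ˡ n₂) j
      HF-H₁₂A≡G j = begin
        (H ⊗ F) (a ↑ˡ n₂) j - (H₁₂ ⊗ A) a j
          ≡⟨ cong (_- (H₁₂ ⊗ A) a j) (vecMat-splitAt n₁ (H (a ↑ˡ n₂)) F j) ⟩
        (H̄₁ ⊗ (F ∘ (_↑ˡ n₂))) a j + (H₁₂ ⊗ A) a j - (H₁₂ ⊗ A) a j
          ≡⟨ //-rightDividesʳ ((H₁₂ ⊗ A) a j) ((H̄₁ ⊗ (F ∘ (_↑ˡ n₂))) a j) ⟩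
        (H̄₁ ⊗ (F ∘ (_↑ˡ n₂))) a j
          ≡⟨ sym (H₁⊗-↑ˡ F a j) ⟩
        G (a ↑ˡ n₂) j
          ∎
        where open ≡-Reasoning

open import Data.Nat using (_+_)
open import Data.Product using (_×_; _,_)
open import Function.Properties.Equivalence using () renaming (trans to ⇔-trans)

theorem25 : (m n₁ n₂ : ℕ) (S : Mat m m) (F : Mat (n₁ + n₂) m) (H : Mat (n₁ + n₂) (n₁ + n₂))
    (T : Mat m m)
    → IsSmith S
    → IsHermiteBasisOf H (RLat S F)
    → IsHermiteBasisOfMat T (stack S (lastRows {n₁} {n₂} F))
    → IsHermiteBasisOf (block (Id n₁) (blk12 H) (Zero n₂ n₁) (blk22 H))
        (RLat S (block (blk11 H) (Zero n₁ n₂) (Zero n₂ n₁) (Id n₂) ⊗ F))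
      × IsHermiteBasisOfMat T (stack S (block (blk11 H) (Zero n₁ n₂) (Zero n₂ n₁) (Id n₂) ⊗ F))
-- S need not be in Smith form: the argument works for any S.
theorem25 m n₁ n₂ S F H T _ basisH@(hermiteH , _) (hermiteT , latticeT) =
    (H₂-hermite hermiteH , H₂-lattice basisH)
  , (hermiteT , λ p → ⇔-trans (stack-H₁⊗-lattice basisH p) (latticeT p))
  where open HermiteSplitting {n₁} {n₂} H
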